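{- Let $\tau,\tau'\in[m]^l$ be two primitive subword patterns with $\tau_1=\tau'_1=a$ and $\tau_l=\tau'_l=b$, where $a<b$. Then for every nonnegative integer $p$, the subword patterns $a^p\tau b^p$ and $a^p\tau' b^p$ (where $a^p$ denotes $p$ consecutive copies of the letter $a$, and juxtaposition is concatenation) are in the same strong Wilf class: for all $k\ge1$, $n\ge0$, $r\ge0$, the number of words in $[k]^n$ containing the first exactly $r$ times equals the number containing the second exactly $r$ times.
   Context: $[k]^n$ is the set of words of length $n$ over $\{1,\dots,k\}$. A subword pattern is a word in $[m]^l$ containing every letter of $[m]$. An occurrence of a pattern $\pi$ of length $L$ in $\sigma=\sigma_1\cdots\sigma_n$ is an index $i$ such that the consecutive factor $\sigma_i\cdots\sigma_{i+L-1}$ is order-isomorphic to $\pi$ (same relative order and same equalities among positions); "containing exactly $r$ times" means having exactly $r$ occurrences. A subword pattern is primitive if any two distinct occurrences of it (in any word) overlap in at most one letter. -}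

module Defs where

open import Data.Nat using (ℕ; zero; suc; _+_; _∸_; _≤_; _<_; _<ᵇ_; _≡ᵇ_)
open import Data.Bool using (Bool; true; false; _∧_)
open import Data.List using (List; []; _∷_; length; take; drop; map; concatMap; upTo; filterᵇ; zip)
open import Data.Bool.ListAction using (all)
open import Data.List.Membership.Propositional using (_∈_)
open import Data.List.Relation.Unary.All using (All)
open import Data.Product using (_×_; _,_; proj₁; proj₂)
open import Relation.Binary.PropositionalEquality using (_≡_)

-- Words are lists of natural numbers (letters); [k]^n = lists of length n with letters in {1..k}.

_⇔ᵇ_ : Bool → Bool → Bool
true  ⇔ᵇ b = b
false ⇔ᵇ true  = false
false ⇔ᵇ false = true

sameRel : ℕ × ℕ → ℕ × ℕ → Bool
sameRel (x , x') (y , y') = ((x <ᵇ y) ⇔ᵇ (x' <ᵇ y')) ∧ ((x ≡ᵇ y) ⇔ᵇ (x' ≡ᵇ y'))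

orderIso : List ℕ → List ℕ → Bool
orderIso u v = (length u ≡ᵇ length v) ∧ all (λ p → all (λ q → sameRel p q) zs) zs
  where zs = zip u v

factor : ℕ → ℕ → List ℕ → List ℕ
factor i L σ = take L (drop i σ)

Occurrence : List ℕ → List ℕ → ℕ → Set
Occurrence π σ i = orderIso (factor i (length π) σ) π ≡ true

-- number of occurrences of π in σ (start positions 0 .. n - L; factors that
-- are too short are rejected by the length check in orderIso)
occ : List ℕ → List ℕ → ℕ
occ π σ = length (filterᵇ (λ i → orderIso (factor i (length π) σ) π) (upTo (suc (length σ ∸ length π))))

words : ℕ → ℕ → List (List ℕ)
words k zero    = [] ∷ []
words k (suc n) = concatMap (λ x → map (x ∷_) (words k n)) (map suc (upTo k))

count : List ℕ → ℕ → ℕ → ℕ → ℕ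
count π k n r = length (filterᵇ (λ σ → occ π σ ≡ᵇ r) (words k n))

IsPattern : ℕ → ℕ → List ℕ → Set
IsPattern m l τ =
  All (λ x → 1 ≤ x × x ≤ m) τ × length τ ≡ l × (∀ c → 1 ≤ c → c ≤ m → c ∈ τ)

-- primitive: any two distinct occurrences (in any word) overlap in at most one letter,
-- i.e. for occurrences i < j, the overlap i + L - j is at most 1
Primitive : List ℕ → Set
Primitive τ = ∀ (σ : List ℕ) (i j : ℕ) → i < j → Occurrence τ σ i → Occurrence τ σ j →
  i + length τ ∸ j ≤ 1

{-# OPTIONS --safe #-}

-- Fix a set S of positions and count the words in which a^p τ b^p occurs at every position of S.
-- Since τ is primitive and a < b, an occurrence of a^p τ b^p can only start at or after the last
-- letter of the τ-block of an earlier occurrence; so the interior of the τ-block of each occurrence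
-- in S meets no other occurrence in S. Rewriting all these interiors to read τ′ instead of τ (each
-- letter of τ′ copied from a position where τ carries that letter; τ and τ′ have the same letters,
-- length, first and last letter) is a bijection onto the words in which a^p τ′ b^p occurs at every
-- position of S. These counts for all S determine, by inclusion–exclusion, the number of words with
-- exactly r occurrences.

module Submission where

open import Defs
open import Data.Nat using (ℕ; _≤_; _<_)
open import Data.List using (List; head; last; replicate; _++_)
open import Data.Maybe using (just)
open import Relation.Binary.PropositionalEquality using (_≡_)

open import Data.Bool using (Bool; true; false; not; _∧_; _∨_; T; T?) renaming (_≟_ to _≟ᵇ_)
open import Data.Bool.ListAction using (all)
open import Data.Bool.Properties using (∧-conicalˡ; ∧-conicalʳ; T-≡)
open import Data.Empty using (⊥; ⊥-elim)
open import Data.List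
  using ([]; _∷_; length; take; drop; map; applyUpTo; upTo; zip; filterᵇ; concatMap; cartesianProductWith)
open import Data.List.Membership.Propositional using (_∈_; lose)
open import Data.List.Membership.Propositional.Properties
  using (∈-∃++; ∈-filter⁻; ∈-filter⁺; ∈-map⁻; ∈-map⁺; ∈-upTo⁻; ∈-upTo⁺; ∈-applyUpTo⁻;
         ∈-cartesianProductWith⁻; ∈-cartesianProductWith⁺)
open import Data.List.Properties
  using (length-take; length-drop; length-zipWith; length-map; length-++; length-replicate; length-upTo; length-applyUpTo;
         ∷-injective; filter-≐)
open import Data.List.Relation.Binary.Subset.Propositional using (_⊆_)
open import Data.List.Relation.Binary.Subset.Propositional.Properties using (++⁺; ⊆-refl)
open import Data.List.Relation.Unary.All as All using (All; []; _∷_)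
import Data.List.Relation.Unary.All.Properties as All
import Data.List.Relation.Unary.AllPairs as AllPairs
open import Data.List.Relation.Unary.Any as Any using (Any; any?; here; there)
open import Data.List.Relation.Unary.Unique.Propositional using (Unique)
import Data.List.Relation.Unary.Unique.Propositional.Properties as Unique
open import Data.Maybe using (Maybe; nothing; maybe′)
open import Data.Maybe.Properties using (just-injective)
open import Data.Nat
  using (zero; suc; _+_; _∸_; _⊓_; _<ᵇ_; _≡ᵇ_; z≤n; s≤s; z<s; s≤s⁻¹; _≤?_; _<?_; _≟_)
open import Data.Nat.Properties
open import Data.Nat.Tactic.RingSolver using (solve-∀)
open import Data.Product using (∃; _×_; _,_; proj₁; proj₂)
open import Data.Sum using (_⊎_; inj₁; inj₂)
open import Function using (_∘_; _∘′_; id)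
open import Function.Bundles using (_⇔_; mk⇔; Equivalence)
open import Relation.Binary using (tri<; tri≈; tri>)
open import Relation.Binary.PropositionalEquality
  using (refl; sym; trans; cong; cong₂; subst; subst₂; _≢_; module ≡-Reasoning)
open import Relation.Nullary using (¬_; Dec; yes; no; _×-dec_)

nth : {A : Set} → A → List A → ℕ → A
nth d []       _       = d
nth d (x ∷ xs) zero    = x
nth d (x ∷ xs) (suc i) = nth d xs i

infixl 10 _‼_
_‼_ : List ℕ → ℕ → ℕ
_‼_ = nth 0

module _ {A : Set} (d : A) where

  nth-++ˡ : ∀ xs {ys i} → i < length xs → nth d (xs ++ ys) i ≡ nth d xs i
  nth-++ˡ (x ∷ xs) {i = zero}  _   = refl
  nth-++ˡ (x ∷ xs) {i = suc i} i<n = nth-++ˡ xs (s≤s⁻¹ i<n)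

  nth-++ʳ : ∀ xs {ys} i → nth d (xs ++ ys) (length xs + i) ≡ nth d ys i
  nth-++ʳ []       i = refl
  nth-++ʳ (x ∷ xs) i = nth-++ʳ xs i

  nth-replicate : ∀ n {x i} → i < n → nth d (replicate n x) i ≡ x
  nth-replicate (suc n) {i = zero}  _   = refl
  nth-replicate (suc n) {i = suc i} i<n = nth-replicate n (s≤s⁻¹ i<n)

  nth-applyUpTo : ∀ f n {i} → i < n → nth d (applyUpTo f n) i ≡ f i
  nth-applyUpTo f (suc n) {zero}  _   = refl
  nth-applyUpTo f (suc n) {suc i} i<n = nth-applyUpTo (f ∘′ suc) n (s≤s⁻¹ i<n)

  nth-drop : ∀ i xs y → nth d (drop i xs) y ≡ nth d xs (i + y)
  nth-drop zero    xs       y = refl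
  nth-drop (suc i) []       y = refl
  nth-drop (suc i) (x ∷ xs) y = nth-drop i xs y

  nth-take : ∀ L xs {y} → y < L → nth d (take L xs) y ≡ nth d xs y
  nth-take (suc L) []       _   = refl
  nth-take (suc L) (x ∷ xs) {zero}  _   = refl
  nth-take (suc L) (x ∷ xs) {suc y} y<L = nth-take L xs (s≤s⁻¹ y<L)

  nth-∈ : ∀ xs {i} → i < length xs → nth d xs i ∈ xs
  nth-∈ (x ∷ xs) {zero}  _   = here refl
  nth-∈ (x ∷ xs) {suc i} i<n = there (nth-∈ xs (s≤s⁻¹ i<n))

  nth-length≤ : ∀ xs {i} → length xs ≤ i → nth d xs i ≡ d
  nth-length≤ []       _   = refl
  nth-length≤ (x ∷ xs) {suc i} n≤i = nth-length≤ xs (s≤s⁻¹ n≤i)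

  ≡-by-nth : ∀ xs ys → length xs ≡ length ys →
             (∀ {i} → i < length xs → nth d xs i ≡ nth d ys i) → xs ≡ ys
  ≡-by-nth []       []       _  _  = refl
  ≡-by-nth (x ∷ xs) (y ∷ ys) eq at = cong₂ _∷_ (at z<s) (≡-by-nth xs ys (suc-injective eq) (at ∘ s≤s))

  all-nth⁻ : ∀ (f : A → Bool) xs → all f xs ≡ true → ∀ {i} → i < length xs → f (nth d xs i) ≡ true
  all-nth⁻ f (x ∷ xs) h {zero}  _   = ∧-conicalˡ (f x) _ h
  all-nth⁻ f (x ∷ xs) h {suc i} i<n = all-nth⁻ f xs (∧-conicalʳ (f x) _ h) (s≤s⁻¹ i<n)

  all-nth⁺ : ∀ (f : A → Bool) xs → (∀ {i} → i < length xs → f (nth d xs i) ≡ true) → all f xs ≡ true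
  all-nth⁺ f []       _  = refl
  all-nth⁺ f (x ∷ xs) at = cong₂ _∧_ (at z<s) (all-nth⁺ f xs (λ i<n → at (s≤s i<n)))

nth-map : ∀ {A B : Set} (d : A) (d′ : B) (f : A → B) xs {i} → i < length xs →
          nth d′ (map f xs) i ≡ f (nth d xs i)
nth-map d d′ f (x ∷ xs) {zero}  _   = refl
nth-map d d′ f (x ∷ xs) {suc i} i<n = nth-map d d′ f xs (s≤s⁻¹ i<n)

nth-zip : ∀ (u v : List ℕ) → length u ≡ length v → ∀ i → nth (0 , 0) (zip u v) i ≡ (u ‼ i , v ‼ i)
nth-zip []       []       _  _       = refl
nth-zip (x ∷ u) (x′ ∷ v) _  zero    = refl
nth-zip (x ∷ u) (x′ ∷ v) eq (suc i) = nth-zip u v (suc-injective eq) i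

⇔ᵇ-true : ∀ {x y} → (x ⇔ᵇ y) ≡ true → x ≡ y
⇔ᵇ-true {true}  {true}  _ = refl
⇔ᵇ-true {false} {false} _ = refl

⇔ᵇ-refl : ∀ x → (x ⇔ᵇ x) ≡ true
⇔ᵇ-refl true  = refl
⇔ᵇ-refl false = refl

sameRel-≡ : ∀ {x x′ y y′} → sameRel (x , x′) (y , y′) ≡ true → (x ≡ y ⇔ x′ ≡ y′)
sameRel-≡ {x} {x′} {y} {y′} h =
  mk⇔ (λ x≡y → ≡ᵇ⇒≡ x′ y′ (subst T same (≡⇒≡ᵇ x y x≡y)))
      (λ x′≡y′ → ≡ᵇ⇒≡ x y (subst T (sym same) (≡⇒≡ᵇ x′ y′ x′≡y′)))
  where
  same : (x ≡ᵇ y) ≡ (x′ ≡ᵇ y′)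
  same = ⇔ᵇ-true (∧-conicalʳ ((x <ᵇ y) ⇔ᵇ (x′ <ᵇ y′)) _ h)

sameRel-+ : ∀ c x y → sameRel (c + x , x) (c + y , y) ≡ true
sameRel-+ zero    x y = cong₂ _∧_ (⇔ᵇ-refl (x <ᵇ y)) (⇔ᵇ-refl (x ≡ᵇ y))
sameRel-+ (suc c) x y = sameRel-+ c x y

OrderIso : List ℕ → List ℕ → Set
OrderIso u v = length u ≡ length v ×
  (∀ {y z} → y < length u → z < length u → sameRel (u ‼ y , v ‼ y) (u ‼ z , v ‼ z) ≡ true)

length-zip : ∀ (u v : List ℕ) → length u ≡ length v → length (zip u v) ≡ length u
length-zip u v eq = trans (length-zipWith _,_ u v) (trans (cong (length u ⊓_) (sym eq)) (⊓-idem (length u)))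

orderIso⇔OrderIso : ∀ u v → orderIso u v ≡ true ⇔ OrderIso u v
orderIso⇔OrderIso u v = mk⇔ to from
  where
  zs = zip u v
  pairs : ∀ {y} → length u ≡ length v → nth (0 , 0) zs y ≡ (u ‼ y , v ‼ y)
  pairs eq = nth-zip u v eq _
  to : orderIso u v ≡ true → OrderIso u v
  to h = eq , λ y<u z<u → subst₂ (λ p q → sameRel p q ≡ true) (pairs eq) (pairs eq)
           (all-nth⁻ (0 , 0) _ zs (all-nth⁻ (0 , 0) _ zs all-pairs (bound y<u)) (bound z<u))
    where
    eq : length u ≡ length v
    eq = ≡ᵇ⇒≡ _ _ (Equivalence.from T-≡ (∧-conicalˡ (length u ≡ᵇ length v) _ h))
    all-pairs = ∧-conicalʳ (length u ≡ᵇ length v) _ h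
    bound : ∀ {y} → y < length u → y < length zs
    bound = subst (_ <_) (sym (length-zip u v eq))
  from : OrderIso u v → orderIso u v ≡ true
  from (eq , rel) = cong₂ _∧_ (Equivalence.to T-≡ (≡⇒≡ᵇ _ _ eq))
    (all-nth⁺ (0 , 0) _ zs λ y<zs → all-nth⁺ (0 , 0) _ zs λ z<zs →
      subst₂ (λ p q → sameRel p q ≡ true) (sym (pairs eq)) (sym (pairs eq)) (rel (bound y<zs) (bound z<zs)))
    where
    bound : ∀ {y} → y < length zs → y < length u
    bound = subst (_ <_) (length-zip u v eq)

length-factor : ∀ i L σ → i + L ≤ length σ → length (factor i L σ) ≡ L
length-factor i L σ fits = begin
  length (take L (drop i σ)) ≡⟨ length-take L (drop i σ) ⟩
  L ⊓ length (drop i σ)      ≡⟨ cong (L ⊓_) (length-drop i σ) ⟩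
  L ⊓ (length σ ∸ i)         ≡⟨ m≤n⇒m⊓n≡m (m+n≤o⇒m≤o∸n L (subst (_≤ length σ) (+-comm i L) fits)) ⟩
  L                          ∎
  where open ≡-Reasoning

length-factor⁻ : ∀ i L σ → 0 < L → length (factor i L σ) ≡ L → i + L ≤ length σ
length-factor⁻ i L σ 0<L eq = subst (_≤ length σ) (+-comm L i) (m≤o∸n⇒m+n≤o L i≤σ L≤σ∸i)
  where
  L≤σ∸i : L ≤ length σ ∸ i
  L≤σ∸i = m⊓n≡m⇒m≤n (trans (sym (cong (L ⊓_) (length-drop i σ))) (trans (sym (length-take L (drop i σ))) eq))
  i≤σ : i ≤ length σ
  i≤σ = <⇒≤ (m∸n≢0⇒n<m (m<n⇒n≢0 (<-≤-trans 0<L L≤σ∸i)))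

factor-‼ : ∀ i L σ {y} → y < L → factor i L σ ‼ y ≡ σ ‼ (i + y)
factor-‼ i L σ y<L = trans (nth-take 0 L (drop i σ) y<L) (nth-drop 0 i σ _)

record OccursAt (π σ : List ℕ) (i : ℕ) : Set where
  field
    fits    : i + length π ≤ length σ
    related : ∀ {y z} → y < length π → z < length π →
              sameRel (σ ‼ (i + y) , π ‼ y) (σ ‼ (i + z) , π ‼ z) ≡ true

occurrence⇒occursAt : ∀ {π σ i} → 0 < length π → Occurrence π σ i → OccursAt π σ i
occurrence⇒occursAt {π} {σ} {i} 0<π occ = record
  { fits    = length-factor⁻ i (length π) σ 0<π eq
  ; related = λ {y} {z} y<π z<π → subst₂ (λ s t → sameRel (s , π ‼ y) (t , π ‼ z) ≡ true)
                (factor-‼ i _ σ y<π) (factor-‼ i _ σ z<π) (rel (inFactor y<π) (inFactor z<π))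
  }
  where
  iso = Equivalence.to (orderIso⇔OrderIso (factor i (length π) σ) π) occ
  eq  = proj₁ iso
  rel = proj₂ iso
  inFactor : ∀ {y} → y < length π → y < length (factor i (length π) σ)
  inFactor = subst (_ <_) (sym eq)

occursAt⇒occurrence : ∀ {π σ i} → OccursAt π σ i → Occurrence π σ i
occursAt⇒occurrence {π} {σ} {i} o = Equivalence.from (orderIso⇔OrderIso (factor i (length π) σ) π)
  ( eq
  , λ {y} {z} y<f z<f → subst₂ (λ s t → sameRel (s , π ‼ y) (t , π ‼ z) ≡ true)
      (sym (factor-‼ i _ σ (inπ y<f))) (sym (factor-‼ i _ σ (inπ z<f))) (OccursAt.related o (inπ y<f) (inπ z<f)))
  where
  eq = length-factor i (length π) σ (OccursAt.fits o)
  inπ : ∀ {y} → y < length (factor i (length π) σ) → y < length π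
  inπ = subst (_ <_) eq

occursAt-≡ : ∀ {π σ i y z} → OccursAt π σ i → y < length π → z < length π →
             (σ ‼ (i + y) ≡ σ ‼ (i + z)) ⇔ (π ‼ y ≡ π ‼ z)
occursAt-≡ o y<π z<π = sameRel-≡ (OccursAt.related o y<π z<π)

occursAt-translate : ∀ {π σ i} c → i + length π ≤ length σ →
                     (∀ {y} → y < length π → σ ‼ (i + y) ≡ c + π ‼ y) → OccursAt π σ i
occursAt-translate {π} c fits shifted = record
  { fits    = fits
  ; related = λ {y} {z} y<π z<π → subst₂ (λ s t → sameRel (s , π ‼ y) (t , π ‼ z) ≡ true)
                (sym (shifted y<π)) (sym (shifted z<π)) (sameRel-+ c (π ‼ y) (π ‼ z))
  }

occursAt-reindex : ∀ {π ρ σ τ i j} (f : ℕ → ℕ) → OccursAt π σ i → j + length τ ≤ length ρ →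
                   (∀ {y} → y < length τ → f y < length π × π ‼ f y ≡ τ ‼ y) →
                   (∀ {y} → y < length τ → ρ ‼ (j + y) ≡ σ ‼ (i + f y)) → OccursAt τ ρ j
occursAt-reindex f o fits letter read = record
  { fits    = fits
  ; related = λ y<τ z<τ → subst₂ (λ s t → sameRel s t ≡ true)
                (cong₂ _,_ (sym (read y<τ)) (proj₂ (letter y<τ)))
                (cong₂ _,_ (sym (read z<τ)) (proj₂ (letter z<τ)))
                (OccursAt.related o (proj₁ (letter y<τ)) (proj₁ (letter z<τ)))
  }

occursAt-copy : ∀ {π π′ σ i j y z y′ z′} → OccursAt π σ i → OccursAt π′ σ j →
                y < length π → z < length π → y′ < length π′ → z′ < length π′ →
                i + y ≡ j + y′ → i + z ≡ j + z′ → π ‼ y ≡ π ‼ z → π′ ‼ y′ ≡ π′ ‼ z′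
occursAt-copy {σ = σ} oi oj y<π z<π y′<π′ z′<π′ same-y same-z π-eq =
  Equivalence.to (occursAt-≡ oj y′<π′ z′<π′)
    (subst₂ (λ s t → σ ‼ s ≡ σ ‼ t) same-y same-z (Equivalence.from (occursAt-≡ oi y<π z<π) π-eq))

primitive-overlap : ∀ {τ σ i j} → Primitive τ → OccursAt τ σ i → OccursAt τ σ j → i < j →
                    i + length τ ≤ suc j
primitive-overlap {τ} {σ} {i} {j} prim oi oj i<j = begin
  i + length τ               ≤⟨ m≤n+m∸n (i + length τ) j ⟩
  j + (i + length τ ∸ j)     ≤⟨ +-monoʳ-≤ j (prim σ i j i<j (occursAt⇒occurrence oi) (occursAt⇒occurrence oj)) ⟩
  j + 1                      ≡⟨ +-comm j 1 ⟩
  suc j                      ∎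
  where open ≤-Reasoning

-- a copy of τ raised by c, overlapping τ in the last two letters of τ
selfOverlap : ℕ → List ℕ → List ℕ
selfOverlap c τ = τ ++ map (c +_) (drop 2 τ)

module _ {τ : List ℕ} {n : ℕ} (c : ℕ) (length≡ : length τ ≡ 3 + n) where

  private
    w = selfOverlap c τ

  length-selfOverlap : length w ≡ (3 + n) + (1 + n)
  length-selfOverlap = begin
    length w                                  ≡⟨ length-++ τ ⟩
    length τ + length (map (c +_) (drop 2 τ)) ≡⟨ cong (length τ +_) (trans (length-map _ (drop 2 τ)) (length-drop 2 τ)) ⟩
    length τ + (length τ ∸ 2)                 ≡⟨ cong (λ l → l + (l ∸ 2)) length≡ ⟩
    (3 + n) + (1 + n)                         ∎
    where open ≡-Reasoning

  occursAt-selfOverlap-start : OccursAt τ w 0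
  occursAt-selfOverlap-start =
    occursAt-translate 0 (subst (length τ ≤_) (sym (length-++ τ)) (m≤m+n _ _)) (nth-++ˡ 0 τ)

  occursAt-selfOverlap-end : c + τ ‼ 0 ≡ τ ‼ suc n → c + τ ‼ 1 ≡ τ ‼ (2 + n) → OccursAt τ w (suc n)
  occursAt-selfOverlap-end first last =
    occursAt-translate c (≤-reflexive (trans (cong (suc n +_) length≡) (trans (span n) (sym length-selfOverlap)))) shifted
    where
    span : ∀ n → suc n + (3 + n) ≡ (3 + n) + (1 + n)
    span = solve-∀
    shift : ∀ n z → suc n + (2 + z) ≡ (3 + n) + z
    shift = solve-∀
    inτ : ∀ {y} → y < 3 + n → y < length τ
    inτ = subst (_ <_) (sym length≡)
    shifted : ∀ {y} → y < length τ → w ‼ (suc n + y) ≡ c + τ ‼ y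
    shifted {zero} _ = begin
      w ‼ (suc n + 0)  ≡⟨ cong (w ‼_) (+-identityʳ (suc n)) ⟩
      w ‼ suc n        ≡⟨ nth-++ˡ 0 τ (inτ (s≤s (s≤s (n≤1+n n)))) ⟩
      τ ‼ suc n        ≡⟨ first ⟨
      c + τ ‼ 0        ∎
      where open ≡-Reasoning
    shifted {suc zero} _ = begin
      w ‼ (suc n + 1)  ≡⟨ cong (w ‼_) (+-comm (suc n) 1) ⟩
      w ‼ (2 + n)      ≡⟨ nth-++ˡ 0 τ (inτ ≤-refl) ⟩
      τ ‼ (2 + n)      ≡⟨ last ⟨
      c + τ ‼ 1        ∎
      where open ≡-Reasoning
    shifted {suc (suc z)} z<τ = begin
      w ‼ (suc n + (2 + z))      ≡⟨ cong (w ‼_) (trans (shift n z) (cong (_+ z) (sym length≡))) ⟩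
      w ‼ (length τ + z)         ≡⟨ nth-++ʳ 0 τ z ⟩
      map (c +_) (drop 2 τ) ‼ z  ≡⟨ nth-map 0 0 (c +_) (drop 2 τ) z<drop ⟩
      c + drop 2 τ ‼ z           ≡⟨ cong (c +_) (nth-drop 0 2 τ z) ⟩
      c + τ ‼ (2 + z)            ∎
      where
      open ≡-Reasoning
      z<drop : z < length (drop 2 τ)
      z<drop = subst (z <_) (sym (length-drop 2 τ)) (∸-monoˡ-< z<τ (s≤s (s≤s z≤n)))

primitive-¬doubledEnds : ∀ {τ n} → Primitive τ → length τ ≡ 3 + n →
                         τ ‼ 0 ≡ τ ‼ 1 → τ ‼ suc n ≡ τ ‼ (2 + n) → τ ‼ 0 ≤ τ ‼ suc n → ⊥
primitive-¬doubledEnds {τ} {n} prim length≡ first≡ last≡ a≤b =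
  <-irrefl refl (subst (_≤ 2 + n) length≡ (primitive-overlap {τ} prim
    (occursAt-selfOverlap-start {τ} c length≡) (occursAt-selfOverlap-end {τ} c length≡ c+a≡b c+a≡b′) z<s))
  where
  c = τ ‼ suc n ∸ τ ‼ 0
  c+a≡b : c + τ ‼ 0 ≡ τ ‼ suc n
  c+a≡b = m∸n+n≡m a≤b
  c+a≡b′ : c + τ ‼ 1 ≡ τ ‼ (2 + n)
  c+a≡b′ = trans (cong (c +_) (sym first≡)) (trans c+a≡b last≡)

pad : ℕ → ℕ → List ℕ → ℕ → List ℕ
pad p a τ b = replicate p a ++ τ ++ replicate p b

record Bracketed (a b n : ℕ) (τ : List ℕ) : Set where
  field
    length≡ : length τ ≡ 2 + n
    first≡  : τ ‼ 0 ≡ a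
    last≡   : τ ‼ suc n ≡ b

module _ {a b n τ} (β : Bracketed a b n τ) (p : ℕ) where
  open Bracketed β

  private
    P = pad p a τ b

  length-pad : length P ≡ p + (2 + n + p)
  length-pad = begin
    length P                                  ≡⟨ length-++ (replicate p a) ⟩
    length (replicate p a) + length (τ ++ _)  ≡⟨ cong₂ _+_ (length-replicate p) (length-++ τ) ⟩
    p + (length τ + length (replicate p b))   ≡⟨ cong (λ l → p + (l + length (replicate p b))) length≡ ⟩
    p + (2 + n + length (replicate p b))      ≡⟨ cong (λ l → p + (2 + n + l)) (length-replicate p) ⟩
    p + (2 + n + p)                           ∎
    where open ≡-Reasoning

  pad-a-run< : ∀ {y} → y ≤ p → y < length P
  pad-a-run< y≤p = subst (_ <_) (sym length-pad) (≤-<-trans y≤p (m<m+n p z<s))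

  pad-τ< : ∀ {z} → z < 2 + n → p + z < length P
  pad-τ< z<τ = subst (_ <_) (sym length-pad) (+-monoʳ-< p (<-≤-trans z<τ (m≤m+n (2 + n) p)))

  pad-b-run< : ∀ {v} → v ≤ p → p + suc n + v < length P
  pad-b-run< {v} v≤p = subst₂ _<_ (sym (+-assoc p (suc n) v)) (sym length-pad) (+-monoʳ-< p (s≤s (+-monoʳ-≤ (suc n) v≤p)))

  pad-‼-τ : ∀ {z} → z < 2 + n → P ‼ (p + z) ≡ τ ‼ z
  pad-‼-τ {z} z<τ = begin
    P ‼ (p + z)                      ≡⟨ cong (λ q → P ‼ (q + z)) (length-replicate p) ⟨
    P ‼ (length (replicate p a) + z) ≡⟨ nth-++ʳ 0 (replicate p a) z ⟩
    (τ ++ replicate p b) ‼ z         ≡⟨ nth-++ˡ 0 τ (subst (z <_) (sym length≡) z<τ) ⟩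
    τ ‼ z                            ∎
    where open ≡-Reasoning

  pad-‼-a : ∀ {y} → y ≤ p → P ‼ y ≡ a
  pad-‼-a {y} y≤p with m≤n⇒m<n∨m≡n y≤p
  ... | inj₁ y<p  = trans (nth-++ˡ 0 (replicate p a) (subst (y <_) (sym (length-replicate p)) y<p))
                          (nth-replicate 0 p y<p)
  ... | inj₂ refl = trans (cong (P ‼_) (sym (+-identityʳ p))) (trans (pad-‼-τ z<s) first≡)

  pad-‼-b : ∀ {v} → v ≤ p → P ‼ (p + suc n + v) ≡ b
  pad-‼-b {zero} _ = begin
    P ‼ (p + suc n + 0) ≡⟨ cong (P ‼_) (+-identityʳ (p + suc n)) ⟩
    P ‼ (p + suc n)     ≡⟨ pad-‼-τ ≤-refl ⟩
    τ ‼ suc n           ≡⟨ last≡ ⟩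
    b                   ∎
    where open ≡-Reasoning
  pad-‼-b {suc v} v<p = begin
    P ‼ (p + suc n + suc v)                                ≡⟨ cong (P ‼_) (reassoc p n v) ⟩
    P ‼ (p + (2 + n + v))                                  ≡⟨ cong₂ (λ q l → P ‼ (q + (l + v))) (length-replicate p) length≡ ⟨
    P ‼ (length (replicate p a) + (length τ + v))          ≡⟨ nth-++ʳ 0 (replicate p a) (length τ + v) ⟩
    (τ ++ replicate p b) ‼ (length τ + v)                  ≡⟨ nth-++ʳ 0 τ v ⟩
    replicate p b ‼ v                                      ≡⟨ nth-replicate 0 p v<p ⟩
    b                                                      ∎
    where
    open ≡-Reasoning
    reassoc : ∀ p n v → p + suc n + suc v ≡ p + (2 + n + v)
    reassoc = solve-∀

  occursAt-middle : ∀ {σ i} → OccursAt P σ i → OccursAt τ σ (i + p)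
  occursAt-middle {σ} {i} o = occursAt-reindex (p +_) o fits
    (λ y<τ → let y<2+n = subst (_ <_) length≡ y<τ in pad-τ< y<2+n , pad-‼-τ y<2+n)
    (λ {y} _ → cong (σ ‼_) (+-assoc i p y))
    where
    fits : i + p + length τ ≤ length σ
    fits = begin
      i + p + length τ             ≡⟨ +-assoc i p (length τ) ⟩
      i + (p + length τ)           ≤⟨ +-monoʳ-≤ i (+-monoʳ-≤ p (m≤m+n (length τ) p)) ⟩
      i + (p + (length τ + p))     ≡⟨ cong (λ l → i + (p + (l + p))) length≡ ⟩
      i + (p + (2 + n + p))        ≡⟨ cong (i +_) length-pad ⟨
      i + length P                 ≤⟨ OccursAt.fits o ⟩
      length σ                     ∎
      where open ≤-Reasoning

primitive-¬doubledBrackets : ∀ {a b n τ} → Primitive τ → Bracketed a b n τ → a < b →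
                             τ ‼ 0 ≡ τ ‼ 1 → τ ‼ n ≡ τ ‼ suc n → ⊥
primitive-¬doubledBrackets {n = zero} _ β a<b a-doubled _ =
  <-irrefl (trans (sym first≡) (trans a-doubled last≡)) a<b
  where open Bracketed β
primitive-¬doubledBrackets {n = suc n} {τ} prim β a<b a-doubled b-doubled =
  primitive-¬doubledEnds {τ} {n} prim length≡ a-doubled b-doubled (subst₂ _≤_ (sym first≡) (sym (trans b-doubled last≡)) (<⇒≤ a<b))
  where open Bracketed β

module _ {a b n τ} (prim : Primitive τ) (β : Bracketed a b n τ) (a<b : a < b) where
  open Bracketed β

  private
    P : ℕ → List ℕ
    P p = pad p a τ b

  pad-occurrences-¬near : ∀ {p σ i j} → OccursAt (P p) σ i → OccursAt (P p) σ j → i < j → j ≤ i + n → ⊥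
  pad-occurrences-¬near {p} {σ} {i} {j} oi oj i<j j≤i+n =
    <-irrefl refl (+-cancelˡ-≤ (i + p) (2 + n) (suc n) (begin
      i + p + (2 + n)   ≡⟨ cong (i + p +_) length≡ ⟨
      i + p + length τ  ≤⟨ primitive-overlap {τ} prim (occursAt-middle β p oi) (occursAt-middle β p oj) (+-monoˡ-< p i<j) ⟩
      suc (j + p)       ≤⟨ s≤s (+-monoˡ-≤ p j≤i+n) ⟩
      suc (i + n + p)   ≡⟨ reassoc i n p ⟩
      i + p + suc n     ∎))
    where
    open ≤-Reasoning
    reassoc : ∀ i n p → suc (i + n + p) ≡ i + p + suc n
    reassoc = solve-∀

  -- With p = 1 + s + r, the a-run of the second occurrence covers the last two letters of the first
  -- τ-block and the b-run of the first covers the first two letters of the second: τ = a a … b b.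
  pad-occurrences-¬mid : ∀ {p σ i s} → OccursAt (P p) σ i → OccursAt (P p) σ (i + suc n + s) → s < p → ⊥
  pad-occurrences-¬mid {σ = σ} {i} {s} oi oj s<p with r , refl ← m≤n⇒∃[o]m+o≡n s<p =
    primitive-¬doubledBrackets prim β a<b a-doubled b-doubled
    where
    p = suc s + r
    r≤p : r ≤ p
    r≤p = m≤n+m r (suc s)
    1+r≤p : suc r ≤ p
    1+r≤p = s≤s (m≤n+m r s)
    s≤p : s ≤ p
    s≤p = ≤-trans (n≤1+n s) (m≤m+n (suc s) r)
    1+s≤p : suc s ≤ p
    1+s≤p = m≤m+n (suc s) r
    eq₁ : ∀ i n s r → i + suc n + s + r ≡ i + (suc s + r + n)
    eq₁ = solve-∀
    eq₂ : ∀ i n s r → i + suc n + s + suc r ≡ i + (suc s + r + suc n)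
    eq₂ = solve-∀
    eq₃ : ∀ i n s r → i + (suc s + r + suc n + s) ≡ i + suc n + s + (suc s + r + 0)
    eq₃ = solve-∀
    eq₄ : ∀ i n s r → i + (suc s + r + suc n + suc s) ≡ i + suc n + s + (suc s + r + 1)
    eq₄ = solve-∀
    n<τ : n < 2 + n
    n<τ = m<n⇒m<1+n (n<1+n n)
    1+n<τ : suc n < 2 + n
    1+n<τ = n<1+n (suc n)
    b-doubled : τ ‼ n ≡ τ ‼ suc n
    b-doubled = trans (sym (pad-‼-τ β p n<τ)) (trans
      (occursAt-copy oj oi (pad-a-run< β p r≤p) (pad-a-run< β p 1+r≤p) (pad-τ< β p n<τ) (pad-τ< β p 1+n<τ)
        (eq₁ i n s r) (eq₂ i n s r) (trans (pad-‼-a β p r≤p) (sym (pad-‼-a β p 1+r≤p))))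
      (pad-‼-τ β p 1+n<τ))
    a-doubled : τ ‼ 0 ≡ τ ‼ 1
    a-doubled = trans (sym (pad-‼-τ β p z<s)) (trans
      (occursAt-copy oi oj (pad-b-run< β p s≤p) (pad-b-run< β p 1+s≤p) (pad-τ< β p z<s) (pad-τ< β p (s≤s z<s))
        (eq₃ i n s r) (eq₄ i n s r) (trans (pad-‼-b β p s≤p) (sym (pad-‼-b β p 1+s≤p))))
      (pad-‼-τ β p (s≤s z<s)))

  pad-separated : ∀ {p σ i j} → OccursAt (P p) σ i → OccursAt (P p) σ j → i < j → i + (p + suc n) ≤ j
  pad-separated {p} {σ} {i} {j} oi oj i<j with i + (p + suc n) ≤? j | j ≤? i + n
  ... | yes apart | _        = apart
  ... | no ¬apart | yes near = ⊥-elim (pad-occurrences-¬near {p} oi oj i<j near)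
  ... | no ¬apart | no ¬near with s , refl ← m≤n⇒∃[o]m+o≡n (subst (_≤ j) (sym (+-suc i n)) (≰⇒> ¬near)) =
    ⊥-elim (pad-occurrences-¬mid {p} oi oj (+-cancelˡ-< (i + suc n) s p (subst (i + suc n + s <_) (reassoc i n p) (≰⇒> ¬apart))))
    where
    reassoc : ∀ i n p → i + (p + suc n) ≡ i + suc n + p
    reassoc = solve-∀

  pad-windows-apart : ∀ {p σ i j y} → OccursAt (P p) σ i → OccursAt (P p) σ j → y < length (P p) →
                      j + suc p ≤ i + y → i + y < j + (p + suc n) → i ≡ j
  pad-windows-apart {p} {σ} {i} {j} {y} oi oj y<P lo hi with <-cmp i j
  ... | tri≈ _ i≡j _ = i≡j
  ... | tri< i<j _ _ = ⊥-elim (<-irrefl refl (begin-strict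
    i + length (P p)           ≡⟨ cong (i +_) (length-pad β p) ⟩
    i + (p + (2 + n + p))      ≡⟨ reassoc i p n ⟩
    i + (p + suc n) + suc p    ≤⟨ +-monoˡ-≤ (suc p) (pad-separated oi oj i<j) ⟩
    j + suc p                  ≤⟨ lo ⟩
    i + y                      <⟨ +-monoʳ-< i y<P ⟩
    i + length (P p)           ∎))
    where
    open ≤-Reasoning
    reassoc : ∀ i p n → i + (p + (2 + n + p)) ≡ i + (p + suc n) + suc p
    reassoc = solve-∀
  ... | tri> _ _ j<i = ⊥-elim (<-irrefl refl (begin-strict
    j + (p + suc n)            ≤⟨ pad-separated oj oi j<i ⟩
    i                          ≤⟨ m≤m+n i y ⟩
    i + y                      <⟨ hi ⟩
    j + (p + suc n)            ∎))
    where open ≤-Reasoning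

pad-⊆ : ∀ {τ τ′} p a b → τ′ ⊆ τ → pad p a τ′ b ⊆ pad p a τ b
pad-⊆ p a b τ′⊆τ = ++⁺ (⊆-refl {x = replicate p a}) (++⁺ τ′⊆τ (⊆-refl {x = replicate p b}))

module _ {a b n τ τ′} (β : Bracketed a b n τ) (β′ : Bracketed a b n τ′) (p : ℕ) where

  length-pads : length (pad p a τ′ b) ≡ length (pad p a τ b)
  length-pads = trans (length-pad β′ p) (sym (length-pad β p))

  pads-agree : ∀ {y} → y < length (pad p a τ b) → y < suc p ⊎ p + suc n ≤ y → pad p a τ′ b ‼ y ≡ pad p a τ b ‼ y
  pads-agree _   (inj₁ y<1+p) = trans (pad-‼-a β′ p (s≤s⁻¹ y<1+p)) (sym (pad-‼-a β p (s≤s⁻¹ y<1+p)))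
  pads-agree y<P (inj₂ e≤y) with v , refl ← m≤n⇒∃[o]m+o≡n e≤y = trans (pad-‼-b β′ p v≤p) (sym (pad-‼-b β p v≤p))
    where
    reassoc : ∀ p n → p + suc n + suc p ≡ p + (2 + n + p)
    reassoc = solve-∀
    v≤p : v ≤ p
    v≤p = s≤s⁻¹ (+-cancelˡ-< (p + suc n) v (suc p)
            (subst (p + suc n + v <_) (trans (length-pad β p) (sym (reassoc p n))) y<P))

countᵇ : {A : Set} → (A → Bool) → List A → ℕ
countᵇ f xs = length (filterᵇ f xs)

countᵇ-map : ∀ {A B : Set} (f : B → Bool) (g : A → B) xs → countᵇ f (map g xs) ≡ countᵇ (λ x → f (g x)) xs
countᵇ-map f g []       = refl
countᵇ-map f g (x ∷ xs) with f (g x)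
... | true  = cong suc (countᵇ-map f g xs)
... | false = countᵇ-map f g xs

countᵇ-cong : ∀ {A : Set} {f g : A → Bool} → (∀ x → f x ≡ g x) → ∀ xs → countᵇ f xs ≡ countᵇ g xs
countᵇ-cong {f = f} {g} f≗g xs =
  cong length (filter-≐ (T? ∘ f) (T? ∘ g) ((λ {x} → subst T (f≗g x)) , (λ {x} → subst T (sym (f≗g x)))) xs)

countᵇ-true : ∀ {A : Set} (xs : List A) → countᵇ (λ _ → true) xs ≡ length xs
countᵇ-true []       = refl
countᵇ-true (x ∷ xs) = cong suc (countᵇ-true xs)

countᵇ-false : ∀ {A : Set} (xs : List A) → countᵇ (λ _ → false) xs ≡ 0
countᵇ-false []       = refl
countᵇ-false (x ∷ xs) = countᵇ-false xs

remove-∈ : ∀ {A : Set} {v w : A} ys zs → v ∈ ys ++ w ∷ zs → v ≢ w → v ∈ ys ++ zs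
remove-∈ []       zs (here v≡w)  v≢w = ⊥-elim (v≢w v≡w)
remove-∈ []       zs (there v∈)  _   = v∈
remove-∈ (y ∷ ys) zs (here v≡y)  _   = here v≡y
remove-∈ (y ∷ ys) zs (there v∈)  v≢w = there (remove-∈ ys zs v∈ v≢w)

injection⇒length≤ : ∀ {A B : Set} (f : A → B) {xs ys} → Unique xs →
                    (∀ {x} → x ∈ xs → f x ∈ ys) →
                    (∀ {x y} → x ∈ xs → y ∈ xs → f x ≡ f y → x ≡ y) → length xs ≤ length ys
injection⇒length≤ f {[]}     _               _    _   = z≤n
injection⇒length≤ f {x ∷ xs} (x∉xs AllPairs.∷ unique) into inj with ys₁ , ys₂ , refl ← ∈-∃++ (into (here refl)) =
  begin
    suc (length xs)                  ≤⟨ s≤s (injection⇒length≤ f unique into′ (λ x∈ y∈ → inj (there x∈) (there y∈))) ⟩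
    suc (length (ys₁ ++ ys₂))        ≡⟨ cong suc (length-++ ys₁) ⟩
    suc (length ys₁ + length ys₂)    ≡⟨ +-suc (length ys₁) (length ys₂) ⟨
    length ys₁ + suc (length ys₂)    ≡⟨ length-++ ys₁ ⟨
    length (ys₁ ++ f x ∷ ys₂)        ∎
  where
  open ≤-Reasoning
  into′ : ∀ {z} → z ∈ xs → f z ∈ ys₁ ++ ys₂
  into′ z∈ = remove-∈ ys₁ ys₂ (into (there z∈)) (λ fz≡fx → All.lookup x∉xs z∈ (inj (here refl) (there z∈) (sym fz≡fx)))

countᵇ-≤-retraction : ∀ {A : Set} {W : List A} {f g : A → Bool} (φ ψ : A → A) → Unique W →
                      (∀ {x} → x ∈ W → f x ≡ true → φ x ∈ W × g (φ x) ≡ true × ψ (φ x) ≡ x) →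
                      countᵇ f W ≤ countᵇ g W
countᵇ-≤-retraction {W = W} {f} {g} φ ψ unique retract =
  injection⇒length≤ φ (Unique.filter⁺ (T? ∘ f) unique) into inj
  where
  selected : ∀ {x} → x ∈ filterᵇ f W → x ∈ W × f x ≡ true
  selected x∈ = let x∈W , fx = ∈-filter⁻ (T? ∘ f) x∈ in x∈W , Equivalence.to T-≡ fx
  into : ∀ {x} → x ∈ filterᵇ f W → φ x ∈ filterᵇ g W
  into x∈ = let x∈W , fx = selected x∈ ; φx∈W , gφx , _ = retract x∈W fx in ∈-filter⁺ (T? ∘ g) φx∈W (Equivalence.from T-≡ gφx)
  inj : ∀ {x y} → x ∈ filterᵇ f W → y ∈ filterᵇ f W → φ x ≡ φ y → x ≡ y
  inj x∈ y∈ φx≡φy = let x∈W , fx = selected x∈ ; y∈W , fy = selected y∈ in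
    trans (sym (proj₂ (proj₂ (retract x∈W fx)))) (trans (cong ψ φx≡φy) (proj₂ (proj₂ (retract y∈W fy))))

Letter : ℕ → ℕ → Set
Letter k x = 1 ≤ x × x ≤ k

words-suc : ∀ k n → words k (suc n) ≡ cartesianProductWith _∷_ (map suc (upTo k)) (words k n)
words-suc k n = go (map suc (upTo k))
  where
  go : ∀ xs → concatMap (λ x → map (x ∷_) (words k n)) xs ≡ cartesianProductWith _∷_ xs (words k n)
  go []       = refl
  go (x ∷ xs) = cong (map (x ∷_) (words k n) ++_) (go xs)

∈-letters⁻ : ∀ {k x} → x ∈ map suc (upTo k) → Letter k x
∈-letters⁻ x∈ with y , y∈ , refl ← ∈-map⁻ suc x∈ = s≤s z≤n , ∈-upTo⁻ y∈

∈-letters⁺ : ∀ {k x} → Letter k x → x ∈ map suc (upTo k)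
∈-letters⁺ {x = suc y} (_ , y<k) = ∈-map⁺ suc (∈-upTo⁺ y<k)

∈-words⁻ : ∀ k n {σ} → σ ∈ words k n → length σ ≡ n × All (Letter k) σ
∈-words⁻ k zero    (here refl) = refl , []
∈-words⁻ k (suc n) σ∈ with x , σ′ , x∈ , σ′∈ , refl ← ∈-cartesianProductWith⁻ _∷_ (map suc (upTo k)) (words k n) (subst (_ ∈_) (words-suc k n) σ∈) =
  let length≡ , letters = ∈-words⁻ k n σ′∈ in cong suc length≡ , ∈-letters⁻ x∈ ∷ letters

∈-words⁺ : ∀ k n {σ} → length σ ≡ n → All (Letter k) σ → σ ∈ words k n
∈-words⁺ k zero    {[]}    _       _                  = here refl
∈-words⁺ k (suc n) {x ∷ σ} length≡ (letter ∷ letters) = subst (_ ∈_) (sym (words-suc k n))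
  (∈-cartesianProductWith⁺ _∷_ (∈-letters⁺ letter) (∈-words⁺ k n (suc-injective length≡) letters))

words-unique : ∀ k n → Unique (words k n)
words-unique k zero    = [] AllPairs.∷ AllPairs.[]
words-unique k (suc n) = subst Unique (sym (words-suc k n))
  (Unique.cartesianProductWith⁺ _∷_ ∷-injective (Unique.map⁺ suc-injective (Unique.upTo⁺ k)) (words-unique k n))

Marked : List Bool → ℕ → Set
Marked S i = nth false S i ≡ true

infix 4 _⊑ᵇ_
_⊑ᵇ_ : List Bool → List Bool → Bool
[]      ⊑ᵇ T = true
(s ∷ S) ⊑ᵇ T = (not s ∨ nth false T 0) ∧ (S ⊑ᵇ drop 1 T)

⊑ᵇ⇒marked : ∀ S T → (S ⊑ᵇ T) ≡ true → ∀ {i} → Marked S i → Marked T i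
⊑ᵇ⇒marked (true ∷ S) T S⊑T {zero}  _ = ∧-conicalˡ (nth false T 0) _ S⊑T
⊑ᵇ⇒marked (s ∷ S)    T S⊑T {suc i} m =
  trans (sym (nth-drop false 1 T i)) (⊑ᵇ⇒marked S (drop 1 T) (∧-conicalʳ (not s ∨ nth false T 0) _ S⊑T) m)

marked⇒⊑ᵇ : ∀ S T → (∀ {i} → Marked S i → Marked T i) → (S ⊑ᵇ T) ≡ true
marked⇒⊑ᵇ []         T _      = refl
marked⇒⊑ᵇ (true ∷ S)  T marked = cong₂ _∧_ (marked {zero} refl) (marked⇒⊑ᵇ S (drop 1 T) (λ m → trans (nth-drop false 1 T _) (marked m)))
marked⇒⊑ᵇ (false ∷ S) T marked = marked⇒⊑ᵇ S (drop 1 T) (λ m → trans (nth-drop false 1 T _) (marked m))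

Vectors : ℕ → List (List Bool) → Set
Vectors N = All (λ T → length T ≡ N)

slice : Bool → List (List Bool) → List (List Bool)
slice b     []                = []
slice b     ([] ∷ A)          = slice b A
slice false ((false ∷ T) ∷ A) = T ∷ slice false A
slice true  ((true  ∷ T) ∷ A) = T ∷ slice true A
slice false ((true  ∷ T) ∷ A) = slice false A
slice true  ((false ∷ T) ∷ A) = slice true A

slice-vectors : ∀ {N} b A → Vectors (suc N) A → Vectors N (slice b A)
slice-vectors b     []                _           = []
slice-vectors false ((false ∷ T) ∷ A) (eq ∷ vecs) = suc-injective eq ∷ slice-vectors false A vecs
slice-vectors true  ((true  ∷ T) ∷ A) (eq ∷ vecs) = suc-injective eq ∷ slice-vectors true A vecs
slice-vectors false ((true  ∷ T) ∷ A) (_  ∷ vecs) = slice-vectors false A vecs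
slice-vectors true  ((false ∷ T) ∷ A) (_  ∷ vecs) = slice-vectors true A vecs

countᵇ-slice : ∀ {N} (Q : List Bool → Bool) A → Vectors (suc N) A →
               countᵇ Q A ≡ countᵇ (λ T → Q (false ∷ T)) (slice false A) + countᵇ (λ T → Q (true ∷ T)) (slice true A)
countᵇ-slice Q []                _           = refl
countᵇ-slice Q ((false ∷ T) ∷ A) (_ ∷ vecs) with Q (false ∷ T)
... | true  = cong suc (countᵇ-slice Q A vecs)
... | false = countᵇ-slice Q A vecs
countᵇ-slice Q ((true ∷ T) ∷ A)  (_ ∷ vecs) with Q (true ∷ T)
... | true  = trans (cong suc (countᵇ-slice Q A vecs)) (sym (+-suc _ _))
... | false = countᵇ-slice Q A vecs

upCount : List (List Bool) → List Bool → ℕ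
upCount A S = countᵇ (S ⊑ᵇ_) A

upCount-true : ∀ {N} A S → Vectors (suc N) A → upCount A (true ∷ S) ≡ upCount (slice true A) S
upCount-true A S vecs = trans (countᵇ-slice _ A vecs) (cong (_+ upCount (slice true A) S) (countᵇ-false (slice false A)))

upCount-false : ∀ {N} A S → Vectors (suc N) A →
                upCount A (false ∷ S) ≡ upCount (slice false A) S + upCount (slice true A) S
upCount-false A S vecs = countᵇ-slice _ A vecs

vectors-zero : ∀ A → Vectors 0 A → A ≡ replicate (length A) []
vectors-zero []       []           = refl
vectors-zero ([] ∷ A) (_ ∷ vecs)  = cong ([] ∷_) (vectors-zero A vecs)

-- Möbius inversion on the Boolean lattice, one coordinate at a time: the up-counts of the vectors
-- starting with true are up-counts of A, those of the vectors starting with false follow by subtraction.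
upCounts-determine-counts : ∀ N {A B} → Vectors N A → Vectors N B → (∀ S → upCount A S ≡ upCount B S) →
                            ∀ Q → countᵇ Q A ≡ countᵇ Q B
upCounts-determine-counts zero {A} {B} vecsA vecsB up Q = cong (countᵇ Q) (begin
  A                         ≡⟨ vectors-zero A vecsA ⟩
  replicate (length A) []   ≡⟨ cong (λ m → replicate m []) (trans (sym (countᵇ-true A)) (trans (up []) (countᵇ-true B))) ⟩
  replicate (length B) []   ≡⟨ vectors-zero B vecsB ⟨
  B                         ∎)
  where open ≡-Reasoning
upCounts-determine-counts (suc N) {A} {B} vecsA vecsB up Q = begin
  countᵇ Q A                                             ≡⟨ countᵇ-slice Q A vecsA ⟩
  countᵇ _ (slice false A) + countᵇ _ (slice true A)     ≡⟨ cong₂ _+_ (recurse false up-false) (recurse true up-true) ⟩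
  countᵇ _ (slice false B) + countᵇ _ (slice true B)     ≡⟨ countᵇ-slice Q B vecsB ⟨
  countᵇ Q B                                             ∎
  where
  open ≡-Reasoning
  recurse : ∀ b → (∀ S → upCount (slice b A) S ≡ upCount (slice b B) S) →
            ∀ {Q′} → countᵇ Q′ (slice b A) ≡ countᵇ Q′ (slice b B)
  recurse b up-b = upCounts-determine-counts N (slice-vectors b A vecsA) (slice-vectors b B vecsB) up-b _
  up-true : ∀ S → upCount (slice true A) S ≡ upCount (slice true B) S
  up-true S = trans (sym (upCount-true A S vecsA)) (trans (up (true ∷ S)) (upCount-true B S vecsB))
  up-false : ∀ S → upCount (slice false A) S ≡ upCount (slice false B) S
  up-false S = +-cancelʳ-≡ (upCount (slice true A) S) _ _ (begin
    upCount (slice false A) S + upCount (slice true A) S   ≡⟨ upCount-false A S vecsA ⟨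
    upCount A (false ∷ S)                                  ≡⟨ up (false ∷ S) ⟩
    upCount B (false ∷ S)                                  ≡⟨ upCount-false B S vecsB ⟩
    upCount (slice false B) S + upCount (slice true B) S   ≡⟨ cong (_ +_) (up-true S) ⟨
    upCount (slice false B) S + upCount (slice true A) S   ∎)

mask : List ℕ → List ℕ → List Bool
mask π σ = map (λ i → orderIso (factor i (length π) σ) π) (upTo (suc (length σ ∸ length π)))

length-mask : ∀ π σ → length (mask π σ) ≡ suc (length σ ∸ length π)
length-mask π σ = trans (length-map _ (upTo (suc (length σ ∸ length π)))) (length-upTo _)

mask-‼ : ∀ π σ {i} → i < suc (length σ ∸ length π) → nth false (mask π σ) i ≡ orderIso (factor i (length π) σ) π
mask-‼ π σ {i} i<N = trans (nth-map 0 false _ (upTo _) (subst (i <_) (sym (length-upTo _)) i<N))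
                           (cong (λ j → orderIso (factor j (length π) σ) π) (nth-applyUpTo 0 id _ i<N))

marked-mask⇒occursAt : ∀ {π σ i} → 0 < length π → Marked (mask π σ) i → OccursAt π σ i
marked-mask⇒occursAt {π} {σ} {i} 0<π marked with i <? suc (length σ ∸ length π)
... | yes i<N = occurrence⇒occursAt 0<π (trans (sym (mask-‼ π σ i<N)) marked)
... | no  i≮N with () ← trans (sym (nth-length≤ false (mask π σ) (subst (_≤ i) (sym (length-mask π σ)) (≮⇒≥ i≮N)))) marked

occursAt⇒marked-mask : ∀ {π σ i} → OccursAt π σ i → Marked (mask π σ) i
occursAt⇒marked-mask {π} {σ} {i} o =
  trans (mask-‼ π σ (s≤s (m+n≤o⇒m≤o∸n i (OccursAt.fits o)))) (occursAt⇒occurrence o)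

masks-vectors : ∀ π k n → Vectors (suc (n ∸ length π)) (map (mask π) (words k n))
masks-vectors π k n = All.map⁺ (All.tabulate λ {σ} σ∈ →
  trans (length-mask π σ) (cong (λ l → suc (l ∸ length π)) (proj₁ (∈-words⁻ k n σ∈))))

count-via-masks : ∀ π k n r → count π k n r ≡ countᵇ (λ M → countᵇ id M ≡ᵇ r) (map (mask π) (words k n))
count-via-masks π k n r = begin
  countᵇ (λ σ → occ π σ ≡ᵇ r) (words k n)                       ≡⟨ countᵇ-cong (λ σ → cong (_≡ᵇ r) (occ≡ σ)) (words k n) ⟩
  countᵇ (λ σ → countᵇ id (mask π σ) ≡ᵇ r) (words k n)          ≡⟨ countᵇ-map _ (mask π) (words k n) ⟨
  countᵇ (λ M → countᵇ id M ≡ᵇ r) (map (mask π) (words k n))    ∎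
  where
  open ≡-Reasoning
  occ≡ : ∀ σ → occ π σ ≡ countᵇ id (mask π σ)
  occ≡ σ = sym (countᵇ-map id (λ i → orderIso (factor i (length π) σ) π) (upTo (suc (length σ ∸ length π))))

firstIndex : List ℕ → ℕ → ℕ
firstIndex []       c = 0
firstIndex (x ∷ xs) c with x ≟ c
... | yes _ = 0
... | no  _ = suc (firstIndex xs c)

firstIndex-∈ : ∀ {c} xs → c ∈ xs → firstIndex xs c < length xs × xs ‼ firstIndex xs c ≡ c
firstIndex-∈ {c} (x ∷ xs) c∈ with x ≟ c | c∈
... | yes x≡c | _          = s≤s z≤n , x≡c
... | no  x≢c | here c≡x   = ⊥-elim (x≢c (sym c≡x))
... | no  x≢c | there c∈xs = let k< , ‼k = firstIndex-∈ xs c∈xs in s≤s k< , ‼k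

occursAt-firstIndex : ∀ {π σ i y} → OccursAt π σ i → y < length π → σ ‼ (i + firstIndex π (π ‼ y)) ≡ σ ‼ (i + y)
occursAt-firstIndex {π} o y<π = let k< , ‼k = firstIndex-∈ π (nth-∈ 0 π y<π) in
  Equivalence.from (occursAt-≡ o k< y<π) ‼k

module Windows (s e : ℕ) (S : List Bool) where

  InWindow : ℕ → ℕ → Set
  InWindow i x = i + s ≤ x × x < i + e

  window-cases : ∀ i y → InWindow i (i + y) ⊎ (y < s ⊎ e ≤ y)
  window-cases i y with s ≤? y | y <? e
  ... | yes s≤y | yes y<e = inj₁ (+-monoʳ-≤ i s≤y , +-monoʳ-< i y<e)
  ... | no  s≰y | _       = inj₂ (inj₁ (≰⇒> s≰y))
  ... | yes _   | no  y≮e = inj₂ (inj₂ (≮⇒≥ y≮e))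

  outside⇒¬InWindow : ∀ {i y} → y < s ⊎ e ≤ y → ¬ InWindow i (i + y)
  outside⇒¬InWindow {i} (inj₁ y<s) (s≤y , _)   = <⇒≱ y<s (+-cancelˡ-≤ i _ _ s≤y)
  outside⇒¬InWindow {i} (inj₂ e≤y) (_   , y<e) = <⇒≱ (+-cancelˡ-< i _ _ y<e) e≤y

  InWindow-offset : ∀ {i x} → InWindow i x → i + (x ∸ i) ≡ x × x ∸ i < e
  InWindow-offset {i} {x} (s≤x , x<e) = i+[x∸i]≡x , +-cancelˡ-< i _ _ (subst (_< i + e) (sym i+[x∸i]≡x) x<e)
    where
    i+[x∸i]≡x : i + (x ∸ i) ≡ x
    i+[x∸i]≡x = m+[n∸m]≡n (≤-trans (m≤m+n i s) s≤x)

  owned? : ∀ x → Dec (Any (λ i → Marked S i × InWindow i x) (upTo (suc x)))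
  owned? x = any? (λ i → (nth false S i ≟ᵇ true) ×-dec ((i + s ≤? x) ×-dec (x <? i + e))) (upTo (suc x))

  owner : ℕ → Maybe ℕ
  owner x with owned? x
  ... | yes owned = just (proj₁ (Any.satisfied owned))
  ... | no  _     = nothing

  owner-just : ∀ {x i} → owner x ≡ just i → Marked S i × InWindow i x
  owner-just {x} eq with owned? x
  owner-just {x} refl | yes owned = proj₂ (Any.satisfied owned)

  -- Offset y of the window of a marked i reads the letter of σ where P carries the letter Q ‼ y.
  source : List ℕ → List ℕ → ℕ → ℕ
  source P Q x = maybe′ (λ i → i + firstIndex P (Q ‼ (x ∸ i))) x (owner x)

  replaceWindows : List ℕ → List ℕ → List ℕ → List ℕ
  replaceWindows P Q σ = applyUpTo (λ x → σ ‼ source P Q x) (length σ)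

  length-replaceWindows : ∀ P Q σ → length (replaceWindows P Q σ) ≡ length σ
  length-replaceWindows P Q σ = length-applyUpTo _ (length σ)

  replaceWindows-‼ : ∀ P Q σ {x} → x < length σ → replaceWindows P Q σ ‼ x ≡ σ ‼ source P Q x
  replaceWindows-‼ P Q σ = nth-applyUpTo 0 _ (length σ)

  module Apart (L : ℕ) (e≤L : e ≤ L)
               (apart : ∀ {i j y} → Marked S i → Marked S j → y < L → InWindow j (i + y) → i ≡ j) where

    owner-unique : ∀ {i x} → Marked S i → InWindow i x → owner x ≡ just i
    owner-unique {i} {x} marked inWindow with owned? x
    ... | yes owned = let j , marked′ , inWindow′ = Any.satisfied owned
                          i+y≡x , y<e = InWindow-offset inWindow in
      cong just (sym (apart marked marked′ (<-≤-trans y<e e≤L) (subst (InWindow j) (sym i+y≡x) inWindow′)))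
    ... | no ¬owned = ⊥-elim (¬owned (lose (∈-upTo⁺ (s≤s i≤x)) (marked , inWindow)))
      where
      i≤x : i ≤ x
      i≤x = ≤-trans (m≤m+n i s) (proj₁ inWindow)

    owner-outside : ∀ {i y} → Marked S i → y < L → ¬ InWindow i (i + y) → owner (i + y) ≡ nothing
    owner-outside {i} {y} marked y<L ¬inWindow with owned? (i + y)
    ... | yes owned = let j , marked′ , inWindow′ = Any.satisfied owned in
      ⊥-elim (¬inWindow (subst (λ k → InWindow k (i + y)) (sym (apart marked marked′ y<L inWindow′)) inWindow′))
    ... | no _ = refl

    record Replaceable (P Q σ : List ℕ) : Set where
      field
        length-P : length P ≡ L
        length-Q : length Q ≡ L
        Q⊆P      : Q ⊆ P
        agree    : ∀ {y} → y < L → y < s ⊎ e ≤ y → Q ‼ y ≡ P ‼ y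
        occurs   : ∀ {i} → Marked S i → OccursAt P σ i

    module _ {P Q σ} (R : Replaceable P Q σ) where
      open Replaceable R

      private
        ρ = replaceWindows P Q σ

      firstIndex-Q : ∀ {y} → y < L → firstIndex P (Q ‼ y) < L × P ‼ firstIndex P (Q ‼ y) ≡ Q ‼ y
      firstIndex-Q y<L = let k< , ‼k = firstIndex-∈ P (Q⊆P (nth-∈ 0 Q (subst (_ <_) (sym length-Q) y<L))) in
        subst (_ <_) length-P k< , ‼k

      occurrence-fits : ∀ {i y} → Marked S i → y < L → i + y < length σ
      occurrence-fits {i} marked y<L =
        <-≤-trans (+-monoʳ-< i (subst (_ <_) (sym length-P) y<L)) (OccursAt.fits (occurs marked))

      replaceWindows-‼-occurrence : ∀ {i y} → Marked S i → y < L → ρ ‼ (i + y) ≡ σ ‼ (i + firstIndex P (Q ‼ y))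
      replaceWindows-‼-occurrence {i} {y} marked y<L with window-cases i y
      ... | inj₁ inWindow = begin
        ρ ‼ (i + y)                                ≡⟨ replaceWindows-‼ P Q σ (occurrence-fits marked y<L) ⟩
        σ ‼ source P Q (i + y)                     ≡⟨ cong (λ o → σ ‼ maybe′ _ (i + y) o) (owner-unique marked inWindow) ⟩
        σ ‼ (i + firstIndex P (Q ‼ (i + y ∸ i)))   ≡⟨ cong (λ z → σ ‼ (i + firstIndex P (Q ‼ z))) (m+n∸m≡n i y) ⟩
        σ ‼ (i + firstIndex P (Q ‼ y))             ∎
        where open ≡-Reasoning
      ... | inj₂ outside = begin
        ρ ‼ (i + y)                                ≡⟨ replaceWindows-‼ P Q σ (occurrence-fits marked y<L) ⟩
        σ ‼ source P Q (i + y)                     ≡⟨ cong (λ o → σ ‼ maybe′ _ (i + y) o) unowned ⟩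
        σ ‼ (i + y)                                ≡⟨ occursAt-firstIndex (occurs marked) (subst (_ <_) (sym length-P) y<L) ⟨
        σ ‼ (i + firstIndex P (P ‼ y))             ≡⟨ cong (λ c → σ ‼ (i + firstIndex P c)) (agree y<L outside) ⟨
        σ ‼ (i + firstIndex P (Q ‼ y))             ∎
        where
        open ≡-Reasoning
        unowned = owner-outside marked y<L (outside⇒¬InWindow outside)

      replaceWindows-unowned : ∀ {x} → owner x ≡ nothing → x < length σ → ρ ‼ x ≡ σ ‼ x
      replaceWindows-unowned {x} unowned x<σ =
        trans (replaceWindows-‼ P Q σ x<σ) (cong (λ o → σ ‼ maybe′ _ x o) unowned)

      replaceWindows-occursAt : ∀ {i} → Marked S i → OccursAt Q ρ i
      replaceWindows-occursAt {i} marked =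
        occursAt-reindex (λ y → firstIndex P (Q ‼ y)) (occurs marked) fits
          (λ y<Q → let k< , ‼k = firstIndex-Q (inL y<Q) in subst (_ <_) (sym length-P) k< , ‼k)
          (λ y<Q → replaceWindows-‼-occurrence marked (inL y<Q))
        where
        inL : ∀ {y} → y < length Q → y < L
        inL = subst (_ <_) length-Q
        fits : i + length Q ≤ length ρ
        fits = subst₂ (λ l n → i + l ≤ n) (trans length-P (sym length-Q)) (sym (length-replaceWindows P Q σ))
                 (OccursAt.fits (occurs marked))

      source< : ∀ {x} → x < length σ → source P Q x < length σ
      source< {x} x<σ with owner x in owned
      ... | nothing = x<σ
      ... | just i  = let marked , inWindow = owner-just owned in
        occurrence-fits marked (proj₁ (firstIndex-Q (<-≤-trans (proj₂ (InWindow-offset inWindow)) e≤L)))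

      replaceWindows-⊆ : ρ ⊆ σ
      replaceWindows-⊆ v∈ρ with x , x<σ , refl ← ∈-applyUpTo⁻ _ v∈ρ = nth-∈ 0 σ (source< x<σ)

    replaceable-inverse : ∀ {P Q σ} (R : Replaceable P Q σ) → P ⊆ Q → Replaceable Q P (replaceWindows P Q σ)
    replaceable-inverse R P⊆Q = record
      { length-P = length-Q
      ; length-Q = length-P
      ; Q⊆P      = P⊆Q
      ; agree    = λ y<L outside → sym (agree y<L outside)
      ; occurs   = replaceWindows-occursAt R
      }
      where open Replaceable R

    replaceWindows-inverse : ∀ {P Q σ} (R : Replaceable P Q σ) → P ⊆ Q →
                             replaceWindows Q P (replaceWindows P Q σ) ≡ σ
    replaceWindows-inverse {P} {Q} {σ} R P⊆Q =
      ≡-by-nth 0 _ σ (trans (length-replaceWindows Q P ρ) (length-replaceWindows P Q σ)) pointwise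
      where
      ρ  = replaceWindows P Q σ
      R′ = replaceable-inverse R P⊆Q
      pointwise : ∀ {x} → x < length (replaceWindows Q P ρ) → replaceWindows Q P ρ ‼ x ≡ σ ‼ x
      pointwise {x} x<ρ′ with owner x in owned
      ... | nothing = trans (replaceWindows-unowned R′ owned x<ρ) (replaceWindows-unowned R owned x<σ)
        where
        x<ρ = subst (x <_) (length-replaceWindows Q P ρ) x<ρ′
        x<σ = subst (x <_) (length-replaceWindows P Q σ) x<ρ
      ... | just i with marked , inWindow ← owner-just owned = begin
        replaceWindows Q P ρ ‼ x                           ≡⟨ cong (replaceWindows Q P ρ ‼_) i+y≡x ⟨
        replaceWindows Q P ρ ‼ (i + y)                     ≡⟨ replaceWindows-‼-occurrence R′ marked y<L ⟩
        ρ ‼ (i + k)                                        ≡⟨ replaceWindows-‼-occurrence R marked (proj₁ (firstIndex-Q R′ y<L)) ⟩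
        σ ‼ (i + firstIndex P (Q ‼ k))                     ≡⟨ cong (λ c → σ ‼ (i + firstIndex P c)) (proj₂ (firstIndex-Q R′ y<L)) ⟩
        σ ‼ (i + firstIndex P (P ‼ y))                     ≡⟨ occursAt-firstIndex (Replaceable.occurs R marked) y<P ⟩
        σ ‼ (i + y)                                        ≡⟨ cong (σ ‼_) i+y≡x ⟩
        σ ‼ x                                              ∎
        where
        open ≡-Reasoning
        y = x ∸ i
        k = firstIndex Q (P ‼ y)
        i+y≡x = proj₁ (InWindow-offset inWindow)
        y<L = <-≤-trans (proj₂ (InWindow-offset inWindow)) e≤L
        y<P = subst (y <_) (sym (Replaceable.length-P R)) y<L

last-‼ : ∀ {τ b} → last τ ≡ just b → τ ‼ (length τ ∸ 1) ≡ b
last-‼ {x ∷ []}     eq = just-injective eq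
last-‼ {x ∷ y ∷ τ} eq = last-‼ {y ∷ τ} eq

head-last⇒length≥2 : ∀ {τ : List ℕ} {a b} → head τ ≡ just a → last τ ≡ just b → a ≢ b → ∃ λ n → length τ ≡ 2 + n
head-last⇒length≥2 {x ∷ []}     refl refl a≢b = ⊥-elim (a≢b refl)
head-last⇒length≥2 {x ∷ y ∷ τ} _  _   _   = length τ , refl

head-last⇒bracketed : ∀ {τ a b n} → head τ ≡ just a → last τ ≡ just b → length τ ≡ 2 + n → Bracketed a b n τ
head-last⇒bracketed {x ∷ τ} {b = b} hd lst length≡ = record
  { length≡ = length≡
  ; first≡  = just-injective hd
  ; last≡   = subst (λ l → (x ∷ τ) ‼ (l ∸ 1) ≡ b) length≡ (last-‼ {x ∷ τ} lst)
  }

pattern-⊆ : ∀ {m l l′ τ τ′} → IsPattern m l τ → IsPattern m l′ τ′ → τ ⊆ τ′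
pattern-⊆ (letters , _) (_ , _ , covers) x∈τ = let 1≤x , x≤m = All.lookup letters x∈τ in covers _ 1≤x x≤m

module _ {a b n τ τ′} (prim : Primitive τ) (β : Bracketed a b n τ) (β′ : Bracketed a b n τ′) (a<b : a < b)
         (τ⊆τ′ : τ ⊆ τ′) (τ′⊆τ : τ′ ⊆ τ) (p : ℕ) where

  private
    P  = pad p a τ b
    P′ = pad p a τ′ b

  -- The windows are the interiors of the τ-blocks, offsets p + 1 … p + n of P; outside them P and P′ agree.
  marked-count-≤ : ∀ k N S → countᵇ (λ σ → S ⊑ᵇ mask P σ) (words k N) ≤ countᵇ (λ σ → S ⊑ᵇ mask P′ σ) (words k N)
  marked-count-≤ k N S =
    countᵇ-≤-retraction (replaceWindows P P′) (replaceWindows P′ P) (words-unique k N) retract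
    where
    open Windows (suc p) (p + suc n) S
    e≤L : p + suc n ≤ length P
    e≤L = subst (p + suc n ≤_) (sym (length-pad β p)) (+-monoʳ-≤ p (≤-trans (n≤1+n (suc n)) (m≤m+n (2 + n) p)))
    0<P : 0 < length P
    0<P = <-≤-trans (<-≤-trans z<s (m≤n+m (suc n) p)) e≤L
    retract : ∀ {σ} → σ ∈ words k N → (S ⊑ᵇ mask P σ) ≡ true →
              replaceWindows P P′ σ ∈ words k N × (S ⊑ᵇ mask P′ (replaceWindows P P′ σ)) ≡ true ×
              replaceWindows P′ P (replaceWindows P P′ σ) ≡ σ
    retract {σ} σ∈ S⊑ =
      ∈-words⁺ k N (trans (length-replaceWindows P P′ σ) length≡) (All.anti-mono (replaceWindows-⊆ R) letters) ,
      marked⇒⊑ᵇ S _ (λ marked → occursAt⇒marked-mask (replaceWindows-occursAt R marked)) ,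
      replaceWindows-inverse R (pad-⊆ p a b τ⊆τ′)
      where
      length≡ = proj₁ (∈-words⁻ k N σ∈)
      letters = proj₂ (∈-words⁻ k N σ∈)
      occurs : ∀ {i} → Marked S i → OccursAt P σ i
      occurs marked = marked-mask⇒occursAt 0<P (⊑ᵇ⇒marked S (mask P σ) S⊑ marked)
      open Apart (length P) e≤L
        (λ mi mj y<P (lo , hi) → pad-windows-apart prim β a<b (occurs mi) (occurs mj) y<P lo hi)
      R : Replaceable P P′ σ
      R = record
        { length-P = refl
        ; length-Q = length-pads β β′ p
        ; Q⊆P      = pad-⊆ p a b τ′⊆τ
        ; agree    = pads-agree β β′ p
        ; occurs   = occurs
        }

pads-upCounts-equal : ∀ {a b n τ τ′} → Primitive τ → Primitive τ′ → Bracketed a b n τ → Bracketed a b n τ′ → a < b →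
                      τ ⊆ τ′ → τ′ ⊆ τ → ∀ p k N S →
                      upCount (map (mask (pad p a τ b)) (words k N)) S ≡ upCount (map (mask (pad p a τ′ b)) (words k N)) S
pads-upCounts-equal {a} {b} {τ = τ} {τ′} prim prim′ β β′ a<b τ⊆τ′ τ′⊆τ p k N S = begin
  upCount (map (mask (pad p a τ b)) (words k N)) S    ≡⟨ countᵇ-map _ (mask (pad p a τ b)) (words k N) ⟩
  countᵇ (λ σ → S ⊑ᵇ mask (pad p a τ b) σ) (words k N)
    ≡⟨ ≤-antisym (marked-count-≤ prim β β′ a<b τ⊆τ′ τ′⊆τ p k N S) (marked-count-≤ prim′ β′ β a<b τ′⊆τ τ⊆τ′ p k N S) ⟩
  countᵇ (λ σ → S ⊑ᵇ mask (pad p a τ′ b) σ) (words k N) ≡⟨ countᵇ-map _ (mask (pad p a τ′ b)) (words k N) ⟨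
  upCount (map (mask (pad p a τ′ b)) (words k N)) S   ∎
  where open ≡-Reasoning

corollary4p4 : (m l a b : ℕ) (τ τ' : List ℕ) →
    IsPattern m l τ → IsPattern m l τ' → Primitive τ → Primitive τ' →
    head τ ≡ just a → head τ' ≡ just a → last τ ≡ just b → last τ' ≡ just b → a < b →
    (p k n r : ℕ) → 1 ≤ k →
    count (replicate p a ++ τ ++ replicate p b) k n r ≡ count (replicate p a ++ τ' ++ replicate p b) k n r
corollary4p4 m l a b τ τ′ pat pat′ prim prim′ hd hd′ lst lst′ a<b p k n r _ = begin
  count P k n r                                                       ≡⟨ count-via-masks P k n r ⟩
  countᵇ (λ M → countᵇ id M ≡ᵇ r) (map (mask P) (words k n))          ≡⟨ upCounts-determine-counts _
                                                                           (masks-vectors P k n) vectors′ upCounts-equal _ ⟩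
  countᵇ (λ M → countᵇ id M ≡ᵇ r) (map (mask P′) (words k n))         ≡⟨ count-via-masks P′ k n r ⟨
  count P′ k n r                                                      ∎
  where
  open ≡-Reasoning
  P  = pad p a τ b
  P′ = pad p a τ′ b
  length≡ = proj₂ (head-last⇒length≥2 hd lst (<⇒≢ a<b))
  β  = head-last⇒bracketed hd lst length≡
  β′ = head-last⇒bracketed hd′ lst′ (trans (trans (proj₁ (proj₂ pat′)) (sym (proj₁ (proj₂ pat)))) length≡)
  vectors′ = subst (λ L → Vectors (suc (n ∸ L)) (map (mask P′) (words k n))) (length-pads β β′ p) (masks-vectors P′ k n)
  upCounts-equal = pads-upCounts-equal prim prim′ β β′ a<b (pattern-⊆ pat pat′) (pattern-⊆ pat′ pat) p k n
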